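{- Let $\mathcal{E}$ be an existential PBES in normal form, let $G$ be the parity game obtained from $\mathcal{E}$ (its dependency space), let $\langle\sim_D,\sim_B\rangle$ be a feasible pair, $\sim=\sim_D\cup\sim_B$, and let $G/{\sim}$ be the reduced parity game. For every $X(\vec v)\in\mathrm{sig}(\mathcal{E})$, player $\circ$ wins $G$ on $X(\vec v)$ if and only if player $\circ$ wins $G/{\sim}$ on $[X(\vec v)]_{\sim}$.
   Context: Normal-form existential PBES: equations $\sigma_i X_i(\vec d)=\bigvee_{1\le k\le m_i}\exists\vec e\,\big(\varphi_{ik}(\vec d,\vec e)\wedge X_{a_{ik1}}(\vec f_{ik1}(\vec d,\vec e))\wedge\cdots\wedge X_{a_{ikp_{ik}}}(\vec f_{ikp_{ik}}(\vec d,\vec e))\big)$, $i=1,\dots,n$, $\sigma_i\in\{\mu,\nu\}$, parameters of $X_i$ over $\mathbb{D}_i$, $\vec e$ over $\mathbb{E}_{ik}$. $\mathrm{sig}(\mathcal{E})=\{X_i(\vec v)\mid\vec v\in\mathbb{D}_i\}$, $B=\{(i,k,\vec v,\vec w)\mid\vec v\in\mathbb{D}_i,\vec w\in\mathbb{E}_{ik}\}$. The rank of $X_i$ is the number of alternations between $\mu$ and $\nu$ in $\nu\sigma_1\cdots\sigma_i$. Dependency space: vertex set $\mathrm{sig}(\mathcal{E})\cup B$ ($\vee$- and $\wedge$-vertices); whenever $\varphi_{ik}(\vec v,\vec w)$ holds there are edges $X_i(\vec v)\to(i,k,\vec v,\vec w)$ and $(i,k,\vec v,\vec w)\to X_{a_{ikj}}(\vec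 f_{ikj}(\vec v,\vec w))$, $j=1,\dots,p_{ik}$; no others. Parity game: token moved along edges by the owner of the current vertex; $\circ$ wins a play iff it reaches a $\Box$-vertex with no successor or is infinite with the largest infinitely-often priority even; a player wins on a vertex if he has a winning strategy from it. The game obtained from $\mathcal{E}$: owner $\circ$ on $\vee$-vertices, $\Box$ on $\wedge$-vertices; priority $u-\mathrm{rank}(X_i)$ on $X_i(\vec v)$ and $0$ on $\wedge$-vertices, $u$ the least even number $\ge$ all ranks. Define $F_{ik}(X_j(\vec v))=\{(i,k,\vec v,\vec w)\mid\varphi_{ik}(\vec v,\vec w)\}$ if $j=i$, else $\emptyset$; $G_{ik}(j,k',\vec v,\vec w)=\{X_{a_{ikl}}(\vec f_{ikl}(\vec v,\vec w))\mid 1\le l\le p_{ik}\}$ if $j=i,k'=k$, else $\emptyset$. Subsets are compared by $\alpha\sim\beta$ iff they meet the same equivalence classes. A pair $\langle\sim_D,\sim_B\rangle$ of equivalences on $\mathrm{sig}(\mathcal{E})$ and $B$ is feasible if: (1) $i\ne j$ implies $X_i(\vec v)\not\sim_D X_j(\vec v')$; (2) $X_i(\vec v)\sim_D X_i(\vec v')$ implies $F_{ik}(X_i(\vec v))\sim_B F_{ik}(X_i(\vec v'))$ for all $k$; (3) $i\ne j$ or $k\ne k'$ implies $(i,k,\vec v,\vec w)\not\sim_B(j,k',\vec v',\vec w')$; (4) $(i,k,\vec v,\vec w)\sim_B(i,k,\vec v',\vec w')$ implies $G_{ik}(i,k,\vec v,\vec w)\sim_D G_{ik}(i,k,\vec v',\vec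 w')$. The reduced parity game $G/{\sim}$ has vertices the $\sim$-classes, an edge $[a]\to[b]$ iff some $a'\sim a,b'\sim b$ have $a'\to b'$ in $G$, and owner and priority of a class given by those of its members (well defined by feasibility). -}

module Defs where

open import Level using (Level; _⊔_; 0ℓ) renaming (suc to lsuc)
open import Data.Nat using (ℕ; zero; suc; _∸_; _≤_; _+_)
  renaming (_⊔_ to _⊔ℕ_)
open import Data.Nat.Divisibility using (_∣_)
open import Data.Fin using (Fin; zero; suc)
open import Data.Bool using (Bool; true)
open import Data.List using (List; []; _∷_; map; foldr)
open import Data.Product using (Σ; ∃; _×_; _,_; proj₁; proj₂)
open import Data.Sum using (_⊎_; inj₁; inj₂)
open import Data.Empty using (⊥)
open import Data.Unit using (⊤)
open import Relation.Nullary using (¬_)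
open import Relation.Binary.PropositionalEquality using (_≡_)
open import Relation.Binary using (Rel; IsEquivalence)
open import Data.Sum.Relation.Binary.Pointwise using (Pointwise)
open import Function.Bundles using (_⇔_; mk⇔)

data Player : Set where
  ○ □ : Player

record Game (a e : Level) : Set (lsuc (a Level.⊔ e)) where
  field
    V     : Set a
    _⇒_   : V → V → Set e
    owner : V → Player
    prio  : V → ℕ

module _ {a e : Level} (G : Game a e) where
  open Game G

  HasSucc : V → Set (a Level.⊔ e)
  HasSucc v = Σ V (λ w → v ⇒ w)

  data Path : V → Set (a Level.⊔ e) where
    start : (v : V) → Path v
    step  : ∀ {v w} → Path v → v ⇒ w → Path w

  origin : ∀ {v} → Path v → V
  origin (start v) = v
  origin (step p _) = origin p

  Strategy○ : Set (a Level.⊔ e)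
  Strategy○ = ∀ {v} → Path v → owner v ≡ ○ → HasSucc v ⊎ ¬ HasSucc v

  Follows : ∀ {v} → HasSucc v ⊎ ¬ HasSucc v → V → Set a
  Follows (inj₁ (w , _)) x = x ≡ w
  Follows (inj₂ _)       x = Level.Lift a ⊥

  ConsistentPath : Strategy○ → ∀ {v} → Path v → Set a
  ConsistentPath σ (start v) = Level.Lift a ⊤
  ConsistentPath σ (step {v} {w} p e) =
    ConsistentPath σ p × ((o : owner v ≡ ○) → Follows (σ p o) w)

  record InfPlay : Set (a Level.⊔ e) where
    field
      pos  : ℕ → V
      edge : (i : ℕ) → pos i ⇒ pos (suc i)

    prefix : (i : ℕ) → Path (pos i)
    prefix zero    = start (pos zero)
    prefix (suc i) = step (prefix i) (edge i)

  open InfPlay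

  ConsistentInf : Strategy○ → InfPlay → Set a
  ConsistentInf σ π =
    (i : ℕ) (o : owner (pos π i) ≡ ○) → Follows (σ (prefix π i) o) (pos π (suc i))

  EvenParity : InfPlay → Set
  EvenParity π = Σ ℕ λ q → (2 ∣ q)
    × ((N : ℕ) → Σ ℕ λ j → (N ≤ j) × (prio (pos π j) ≡ q))
    × Σ ℕ (λ N → (j : ℕ) → N ≤ j → prio (pos π j) ≤ q)

  ○Wins : V → Set (a Level.⊔ e)
  ○Wins v0 = Σ Strategy○ λ σ →
      (∀ {v} (p : Path v) → origin p ≡ v0 → ConsistentPath σ p → ¬ HasSucc v
         → owner v ≡ □)
    × ((π : InfPlay) → pos π zero ≡ v0 → ConsistentInf σ π → EvenParity π)

data Fix : Set where
  μ ν : Fix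

record PBES : Set₁ where
  field
    n  : ℕ
    σ  : Fin n → Fix
    D  : Fin n → Set
    m  : Fin n → ℕ
    E  : (i : Fin n) → Fin (m i) → Set
    φ  : (i : Fin n) (k : Fin (m i)) → D i → E i k → Bool
    p  : (i : Fin n) → Fin (m i) → ℕ
    a  : (i : Fin n) (k : Fin (m i)) → Fin (p i k) → Fin n
    f  : (i : Fin n) (k : Fin (m i)) (l : Fin (p i k)) → D i → E i k → D (a i k l)

diff : Fix → Fix → ℕ
diff μ μ = 0
diff ν ν = 0
diff μ ν = 1
diff ν μ = 1

alternations : List Fix → ℕ
alternations [] = 0
alternations (x ∷ []) = 0
alternations (x ∷ y ∷ r) = diff x y + alternations (y ∷ r)

-- σ_1 ⋯ σ_i (Fin-indexed from 0)
upToσ : ∀ {n} → (Fin n → Fix) → Fin n → List Fix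
upToσ σ zero    = σ zero ∷ []
upToσ σ (suc j) = σ zero ∷ upToσ (λ x → σ (suc x)) j

allFinL : (n : ℕ) → List (Fin n)
allFinL zero    = []
allFinL (suc n) = zero ∷ map suc (allFinL n)

evenCeil : ℕ → ℕ
evenCeil zero = zero
evenCeil (suc zero) = 2
evenCeil (suc (suc m)) = suc (suc (evenCeil m))

module PBESGame (𝓔 : PBES) where
  open PBES 𝓔

  rank : Fin n → ℕ
  rank i = alternations (ν ∷ upToσ σ i)

  u : ℕ
  u = evenCeil (foldr _⊔ℕ_ 0 (map rank (allFinL n)))

  Sig : Set
  Sig = Σ (Fin n) D

  B : Set
  B = Σ (Fin n) λ i → Σ (Fin (m i)) λ k → D i × E i k

  Vtx : Set
  Vtx = Sig ⊎ B

  data Edge : Vtx → Vtx → Set where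
    orE  : ∀ i k v w → φ i k v w ≡ true →
           Edge (inj₁ (i , v)) (inj₂ (i , k , v , w))
    andE : ∀ i k v w l → φ i k v w ≡ true →
           Edge (inj₂ (i , k , v , w)) (inj₁ (a i k l , f i k l v w))

  ownerV : Vtx → Player
  ownerV (inj₁ _) = ○
  ownerV (inj₂ _) = □

  prioV : Vtx → ℕ
  prioV (inj₁ (i , _)) = u ∸ rank i
  prioV (inj₂ _)       = 0

  game : Game 0ℓ 0ℓ
  game = record { V = Vtx ; _⇒_ = Edge ; owner = ownerV ; prio = prioV }

  data F : (i : Fin n) (k : Fin (m i)) → Sig → B → Set where
    inF : ∀ i k v w → φ i k v w ≡ true → F i k (i , v) (i , k , v , w)

  data G : (i : Fin n) (k : Fin (m i)) → B → Sig → Set where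
    inG : ∀ i k v w l → G i k (i , k , v , w) (a i k l , f i k l v w)

  -- α ∼ β iff they meet the same equivalence classes
  SameClasses : {X : Set} → Rel X 0ℓ → (X → Set) → (X → Set) → Set
  SameClasses {X} R α β =
    (c : X) → (Σ X λ x → α x × R x c) ⇔ (Σ X λ y → β y × R y c)

  record Feasible (_∼D_ : Rel Sig 0ℓ) (_∼B_ : Rel B 0ℓ) : Set where
    field
      equivD : IsEquivalence _∼D_
      equivB : IsEquivalence _∼B_
      f1 : ∀ {i j} {v : D i} {v' : D j} → ¬ (i ≡ j) → ¬ ((i , v) ∼D (j , v'))
      f2 : ∀ {i} {v v' : D i} → (i , v) ∼D (i , v') →
           (k : Fin (m i)) → SameClasses _∼B_ (F i k (i , v)) (F i k (i , v'))
      f3 : ∀ {i j} {k : Fin (m i)} {k' : Fin (m j)} {v : D i} {w : E i k}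
             {v' : D j} {w' : E j k'} →
           ¬ (_≡_ {A = Σ (Fin n) (λ x → Fin (m x))} (i , k) (j , k')) →
           ¬ ((i , k , v , w) ∼B (j , k' , v' , w'))
      f4 : ∀ {i} {k : Fin (m i)} {v v' : D i} {w w' : E i k} →
           (i , k , v , w) ∼B (i , k , v' , w') →
           SameClasses _∼D_ (G i k (i , k , v , w)) (G i k (i , k , v' , w'))

  module Reduced (_∼D_ : Rel Sig 0ℓ) (_∼B_ : Rel B 0ℓ) where
    _∼_ : Rel Vtx 0ℓ
    _∼_ = Pointwise _∼D_ _∼B_

    record Class : Set₁ where
      field
        mem     : Vtx → Set
        rep     : Vtx
        isClass : (x : Vtx) → mem x ⇔ (rep ∼ x)
    open Class

    [_] : Vtx → Class
    [ x ] = record { mem = λ y → x ∼ y ; rep = x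
                   ; isClass = λ y → mk⇔ (λ h → h) (λ h → h) }

    _⇒q_ : Class → Class → Set
    C ⇒q C' = Σ Vtx λ x → Σ Vtx λ y → mem C x × mem C' y × Edge x y

    reduced : Game (lsuc 0ℓ) 0ℓ
    reduced = record { V = Class ; _⇒_ = _⇒q_
                     ; owner = λ C → ownerV (rep C)
                     ; prio  = λ C → prioV (rep C) }

-- A feasible pair makes ∼ a bisimulation between the game and its quotient on live vertices:
-- equivalent vertices have the same owner and priority (conditions (1) and (3) force equal
-- indices), and by conditions (2) and (4) every move out of a class is matched, with the same
-- label, by a move of each live member.  A winning strategy is therefore transported in either
-- direction by simulation: a play of the quotient is shadowed by a play of the game through its
-- classes, and a play of the game is mirrored by the play of the classes it visits.  The two plays
-- see the same owners and priorities, hence have the same winner.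
module Submission where

open import Defs
open import Level using (Level; _⊔_; 0ℓ; lift)
open import Data.Nat using (zero; suc; _≤_)
open import Data.Fin using (Fin)
open import Data.Fin.Properties using (_≟_)
open import Data.Bool using (Bool; true)
open import Data.Bool.Properties using () renaming (_≟_ to _≟ᴮ_)
open import Data.Maybe using (Maybe; just; nothing)
open import Data.Product using (Σ; _×_; _,_; proj₁; proj₂)
import Data.Product.Properties as Σ
open import Data.Sum using (_⊎_; inj₁; inj₂)
import Data.Sum.Properties as ⊎
import Data.Sum.Relation.Binary.Pointwise as Pointwise
open import Data.Unit using (⊤; tt)
open import Relation.Nullary using (¬_; yes; no; contradiction)
open import Relation.Nullary.Decidable using (decidable-stable)
open import Relation.Binary using (Rel; IsEquivalence; DecidableEquality)
open import Relation.Binary.PropositionalEquality hiding ([_])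
open import Function.Bundles using (Equivalence; _⇔_; mk⇔)
open import Axiom.UniquenessOfIdentityProofs.WithK using (uip)


module _ {a e : Level} (G : Game a e) where
  open Game G
  open InfPlay

  WinningFrom : Strategy○ G → V → Set (a ⊔ e)
  WinningFrom σ v₀ =
      (∀ {v} (p : Path G v) → origin G p ≡ v₀ → ConsistentPath G σ p → ¬ HasSucc G v
         → owner v ≡ □)
    × ((π : InfPlay G) → pos π zero ≡ v₀ → ConsistentInf G σ π → EvenParity G π)

  Admissible : Strategy○ G → V → ∀ {v} → Path G v → Set a
  Admissible σ v₀ p = origin G p ≡ v₀ × ConsistentPath G σ p

  prefix-admissible : ∀ {σ : Strategy○ G} {v₀} (π : InfPlay G) → pos π zero ≡ v₀ →
                      ConsistentInf G σ π → ∀ j → Admissible σ v₀ (prefix π j)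
  prefix-admissible π π₀ c zero    = π₀ , lift tt
  prefix-admissible π π₀ c (suc j) =
    let o , cp = prefix-admissible π π₀ c j in o , cp , c j

  follows-chosen : ∀ {σ : Strategy○ G} {v w} (p : Path G v) {o : owner v ≡ ○} {e : v ⇒ w} →
                   σ p o ≡ inj₁ (w , e) → (o′ : owner v ≡ ○) → Follows G (σ p o′) w
  follows-chosen p {o} chosen o′ rewrite uip o′ o | chosen = refl

  consistentInf-from-prefixes : ∀ {σ : Strategy○ G} (π : InfPlay G) →
    (∀ j → ConsistentPath G σ (prefix π j)) → ConsistentInf G σ π
  consistentInf-from-prefixes π c j = proj₂ (c (suc j))

module _ {a₁ e₁ a₂ e₂ : Level} {T : Game a₁ e₁} {S : Game a₂ e₂} where
  private
    module T = Game T
    module S = Game S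
  open InfPlay

  evenParity-transfer : (π : InfPlay T) (π′ : InfPlay S) →
    (∀ j → S.prio (pos π′ j) ≡ T.prio (pos π j)) → EvenParity S π′ → EvenParity T π
  evenParity-transfer π π′ eq (q , even , often , N , bounded) =
      q , even
    , (λ M → let j , M≤j , q≡ = often M in j , M≤j , trans (sym (eq j)) q≡)
    , N , λ j N≤j → subst (_≤ q) (eq j) (bounded j N≤j)

  record Simulation (σT : Strategy○ T) (t₀ : T.V) (σS : Strategy○ S) (s₀ : S.V)
                    : Set (a₁ ⊔ e₁ ⊔ a₂ ⊔ e₂) where
    field
      image            : ∀ {t} → Path T t → S.V
      trace            : ∀ {t} (p : Path T t) → Path S (image p)
      trace-start      : ∀ t → trace (start t) ≡ start (image (start t))
      trace-step       : ∀ {t t′} (p : Path T t) (e : t T.⇒ t′) → Admissible T σT t₀ (step p e) →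
                         Σ (image p S.⇒ image (step p e)) λ ε → trace (step p e) ≡ step (trace p) ε
      trace-admissible : ∀ {t} (p : Path T t) → Admissible T σT t₀ p → Admissible S σS s₀ (trace p)
      owner-image      : ∀ {t} (p : Path T t) → Admissible T σT t₀ p → S.owner (image p) ≡ T.owner t
      prio-image       : ∀ {t} (p : Path T t) → Admissible T σT t₀ p → S.prio (image p) ≡ T.prio t
      dead-end         : ∀ {t} (p : Path T t) → Admissible T σT t₀ p → ¬ HasSucc T t →
                         ¬ HasSucc S (image p) ⊎ T.owner t ≡ □

  simulation-winning : ∀ {σT : Strategy○ T} {t₀} {σS : Strategy○ S} {s₀} →
                       Simulation σT t₀ σS s₀ → WinningFrom S σS s₀ → WinningFrom T σT t₀
  simulation-winning {σT} {t₀} {σS} {s₀} sim (stuck⇒□ , infinite⇒even) = stuck , infinite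
    where
    open Simulation sim

    stuck : ∀ {t} (p : Path T t) → origin T p ≡ t₀ → ConsistentPath T σT p → ¬ HasSucc T t →
            T.owner t ≡ □
    stuck p o cp dead with dead-end p (o , cp) dead
    ... | inj₂ □-owned = □-owned
    ... | inj₁ deadS   = let oS , cS = trace-admissible p (o , cp) in
                         trans (sym (owner-image p (o , cp))) (stuck⇒□ (trace p) oS cS deadS)

    infinite : (π : InfPlay T) → pos π zero ≡ t₀ → ConsistentInf T σT π → EvenParity T π
    infinite π π₀ c = evenParity-transfer π π′ (λ j → prio-image (prefix π j) (adm j))
      (infinite⇒even π′ (proj₁ (adm′ zero))
                        (consistentInf-from-prefixes S π′ (λ j → proj₂ (adm′ j))))
      where
      adm : ∀ j → Admissible T σT t₀ (prefix π j)
      adm = prefix-admissible T π π₀ c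

      traced-edge : ∀ j → Σ (image (prefix π j) S.⇒ image (prefix π (suc j)))
                            λ ε → trace (prefix π (suc j)) ≡ step (trace (prefix π j)) ε
      traced-edge j = trace-step (prefix π j) (edge π j) (adm (suc j))

      π′ : InfPlay S
      π′ = record { pos = λ j → image (prefix π j) ; edge = λ j → proj₁ (traced-edge j) }

      prefix-trace : ∀ j → prefix π′ j ≡ trace (prefix π j)
      prefix-trace zero    = sym (trace-start (pos π zero))
      prefix-trace (suc j) =
        trans (cong (λ q → step q (edge π′ j)) (prefix-trace j)) (sym (proj₂ (traced-edge j)))

      adm′ : ∀ j → Admissible S σS s₀ (prefix π′ j)
      adm′ j = subst (Admissible S σS s₀) (sym (prefix-trace j)) (trace-admissible _ (adm j))

module _ (𝓔 : PBES) where
  open PBES 𝓔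
  open PBESGame 𝓔

  Kind : Set
  Kind = Fin n ⊎ Σ (Fin n) (λ i → Fin (m i))

  kind : Vtx → Kind
  kind (inj₁ (i , _))         = inj₁ i
  kind (inj₂ (i , k , _ , _)) = inj₂ (i , k)

  _≟ᴷ_ : DecidableEquality Kind
  _≟ᴷ_ = ⊎.≡-dec _≟_ (Σ.≡-dec _≟_ _≟_)

  Move : Kind → Set
  Move (inj₁ i)       = Σ (Fin (m i)) (E i)
  Move (inj₂ (i , k)) = Fin (p i k)

  target : (x : Vtx) → Move (kind x) → Vtx
  target (inj₁ (i , v))         (k , w) = inj₂ (i , k , v , w)
  target (inj₂ (i , k , v , w)) l       = inj₁ (a i k l , f i k l v w)

  enabled : (x : Vtx) → Move (kind x) → Bool
  enabled (inj₁ (i , v))         (k , w) = φ i k v w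
  enabled (inj₂ (i , k , v , w)) _       = φ i k v w

  move-edge : ∀ x c → enabled x c ≡ true → Edge x (target x c)
  move-edge (inj₁ (i , v))         (k , w) en = orE i k v w en
  move-edge (inj₂ (i , k , v , w)) l       en = andE i k v w l en

  label : ∀ {x y} → Edge x y → Move (kind x)
  label (orE _ k _ w _)    = k , w
  label (andE _ _ _ _ l _) = l

  -- An ∧-vertex whose φ is false has no successor, yet may be equivalent to one that has; no edge
  -- enters such a vertex, so the simulations never meet it.
  Live : Vtx → Set
  Live (inj₁ _)               = ⊤
  Live (inj₂ (i , k , v , w)) = φ i k v w ≡ true

  edge-live : ∀ {x y} → Edge x y → Live y
  edge-live (orE _ _ _ _ en)    = en
  edge-live (andE _ _ _ _ _ _) = tt

  ○-live : ∀ {x} → ownerV x ≡ ○ → Live x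
  ○-live {inj₁ _} _ = tt

  try-move : (x : Vtx) → Move (kind x) → Maybe (HasSucc game x)
  try-move x c with enabled x c ≟ᴮ true
  ... | yes en = just (target x c , move-edge x c en)
  ... | no _   = nothing

  try-move-enabled : ∀ x c → enabled x c ≡ true →
                     Σ (Edge x (target x c)) λ e → try-move x c ≡ just (target x c , e)
  try-move-enabled x c en with enabled x c ≟ᴮ true
  ... | yes en′ = move-edge x c en′ , refl
  ... | no ¬en  = contradiction en ¬en

  -- A strategy must answer on every history, and it cannot be decided whether a simulated play is
  -- still at the vertex it should be at.  Moves are instead transplanted by label, which is
  -- decidable since φ is Boolean, and which is the identity on the intended vertex (retarget-self).
  retarget : ∀ {κ} (x : Vtx) → Move κ → Maybe (HasSucc game x)
  retarget {κ} x c with κ ≟ᴷ kind x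
  ... | no _    = nothing
  ... | yes κ≡ = try-move x (subst Move κ≡ c)

  retarget-self : ∀ x c → enabled x c ≡ true →
                  Σ (Edge x (target x c)) λ e → retarget x c ≡ just (target x c , e)
  retarget-self x c en with kind x ≟ᴷ kind x
  ... | no ≢    = contradiction refl ≢
  ... | yes κ≡ rewrite uip κ≡ refl = try-move-enabled x c en

  retarget-label : ∀ {x y} (e : Edge x y) → Σ (Edge x y) λ e′ → retarget x (label e) ≡ just (y , e′)
  retarget-label (orE i k v w en)    = retarget-self (inj₁ (i , v)) (k , w) en
  retarget-label (andE i k v w l en) = retarget-self (inj₂ (i , k , v , w)) l en

module _ (𝓔 : PBES) (_∼D_ : Rel (PBESGame.Sig 𝓔) 0ℓ) (_∼B_ : Rel (PBESGame.B 𝓔) 0ℓ)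
         (feasible : PBESGame.Feasible 𝓔 _∼D_ _∼B_) where
  open PBES 𝓔
  open PBESGame 𝓔
  open Reduced _∼D_ _∼B_
  open Feasible feasible
  open Class
  private
    module ∼ = IsEquivalence (Pointwise.⊎-isEquivalence equivD equivB)
    module ∼D = IsEquivalence equivD
    module ∼B = IsEquivalence equivB

  ∼D⇒index≡ : ∀ {i j} {v : D i} {v′ : D j} → (i , v) ∼D (j , v′) → i ≡ j
  ∼D⇒index≡ {i} {j} h = decidable-stable (i ≟ j) (λ i≢j → f1 i≢j h)

  ∼B⇒index≡ : ∀ {i j} {k : Fin (m i)} {k′ : Fin (m j)}
                {v : D i} {w : E i k} {v′ : D j} {w′ : E j k′} →
              (i , k , v , w) ∼B (j , k′ , v′ , w′) →
              _≡_ {A = Σ (Fin n) (λ i → Fin (m i))} (i , k) (j , k′)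
  ∼B⇒index≡ h = decidable-stable (Σ.≡-dec _≟_ _≟_ _ _) (λ ik≢jk′ → f3 ik≢jk′ h)

  ∼⇒owner≡ : ∀ {x y} → x ∼ y → ownerV x ≡ ownerV y
  ∼⇒owner≡ (Pointwise.inj₁ _) = refl
  ∼⇒owner≡ (Pointwise.inj₂ _) = refl

  ∼⇒prio≡ : ∀ {x y} → x ∼ y → prioV x ≡ prioV y
  ∼⇒prio≡ (Pointwise.inj₁ h) with ∼D⇒index≡ h
  ... | refl = refl
  ∼⇒prio≡ (Pointwise.inj₂ _) = refl

  ∼-step : ∀ {x x′ y′} → x ∼ x′ → Edge x′ y′ →
           Σ (Move 𝓔 (kind 𝓔 x)) λ c →
             (Live 𝓔 x → enabled 𝓔 x c ≡ true) × y′ ∼ target 𝓔 x c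
  ∼-step (Pointwise.inj₁ h) (orE i k v′ w en) with ∼D⇒index≡ h
  ... | refl with Equivalence.from (f2 h k (i , k , v′ , w)) (_ , inF i k v′ w en , ∼B.refl)
  ...   | _ , inF _ _ _ w′ en′ , rel = (k , w′) , (λ _ → en′) , Pointwise.inj₂ (∼B.sym rel)
  ∼-step (Pointwise.inj₂ h) (andE i k v′ w′ l _) with ∼B⇒index≡ h
  ... | refl with Equivalence.from (f4 h (a i k l , f i k l v′ w′)) (_ , inG i k v′ w′ l , ∼D.refl)
  ...   | _ , inG _ _ _ _ l′ , rel = l′ , (λ live → live) , Pointwise.inj₁ (∼D.sym rel)

  class-step : ∀ {C C′ x} → rep C ∼ x → C ⇒q C′ →
               Σ (Move 𝓔 (kind 𝓔 x)) λ c →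
                 (Live 𝓔 x → enabled 𝓔 x c ≡ true) × rep C′ ∼ target 𝓔 x c
  class-step {C} {C′} rel (_ , _ , x′∈C , y′∈C′ , e) =
    let c , en , y′∼ = ∼-step (∼.trans (∼.sym rel) (Equivalence.to (isClass C _) x′∈C)) e
    in c , en , ∼.trans (Equivalence.to (isClass C′ _) y′∈C′) y′∼

  class-edge : ∀ {C x y} → rep C ∼ x → Edge x y → C ⇒q [ y ]
  class-edge {C} rel e = _ , _ , Equivalence.from (isClass C _) rel , ∼.refl , e

  class-stuck : ∀ {C x} → rep C ∼ x → Live 𝓔 x → ¬ HasSucc game x → ¬ HasSucc reduced C
  class-stuck {C} {x} rel live stuck (C′ , ε) =
    let c , en , _ = class-step {C} {C′} rel ε in stuck (_ , move-edge 𝓔 x c (en live))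

  retarget-class-step : ∀ {C C′ x} (rel : rep C ∼ x) (ε : C ⇒q C′) → Live 𝓔 x →
    let c = proj₁ (class-step {C} {C′} rel ε) in
    Σ (Edge x (target 𝓔 x c)) λ e → retarget 𝓔 x c ≡ just (target 𝓔 x c , e)
  retarget-class-step {C} {C′} rel ε live =
    retarget-self 𝓔 _ _ (proj₁ (proj₂ (class-step {C} {C′} rel ε)) live)

  member-stuck : ∀ {C x} → rep C ∼ x → ¬ HasSucc reduced C → ¬ HasSucc game x
  member-stuck {C} rel stuck (y , e) = stuck ([ y ] , class-edge {C} rel e)

  module GameToQuotient (σ₁ : Strategy○ game) where

    -- On admissible histories the shadow play ends at the anchor, a member of the current class
    -- (see Tracks); σ₁ is consulted on the shadow and its move transplanted to the anchor.
    record Shadow (C : Class) : Set where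
      constructor shadow
      field
        anchor   : Vtx
        anchored : rep C ∼ anchor
        {end}    : Vtx
        path     : Path game end
    open Shadow

    restart : (C : Class) → Shadow C
    restart C = shadow (rep C) ∼.refl (start (rep C))

    σ₁-at : ∀ {s} → Path game s → (r : Vtx) → Maybe (HasSucc game r)
    σ₁-at {inj₁ _} q r with σ₁ q refl
    ... | inj₁ (_ , e) = retarget 𝓔 r (label 𝓔 e)
    ... | inj₂ _       = nothing
    σ₁-at {inj₂ _} _ _ = nothing

    fresh-move : ∀ {C x} → rep C ∼ x → ownerV x ≡ ○ → HasSucc reduced C ⊎ ¬ HasSucc reduced C
    fresh-move {C} {x} rel o with σ₁ (start x) o
    ... | inj₁ (y , e) = inj₁ ([ y ] , class-edge {C} rel e)
    ... | inj₂ stuck   = inj₂ (class-stuck {C} rel (○-live 𝓔 o) stuck)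

    respond : (C : Class) → Shadow C → ownerV (rep C) ≡ ○ → HasSucc reduced C ⊎ ¬ HasSucc reduced C
    respond C (shadow r rel q) o with σ₁-at q r
    ... | just (y , e) = inj₁ ([ y ] , class-edge {C} rel e)
    ... | nothing      = fresh-move {C} rel (trans (sym (∼⇒owner≡ rel)) o)

    advance : ∀ {C C′} → Shadow C → C ⇒q C′ → Shadow C′
    advance {C′ = C′} (shadow (inj₁ _) _ {inj₁ _} q) _ with σ₁ q refl
    ... | inj₁ (_ , e) = shadow (rep C′) ∼.refl (step q e)
    ... | inj₂ _       = restart C′
    advance {C′ = C′} (shadow (inj₁ _) _ {inj₂ _} _) _ = restart C′
    advance {C} {C′} (shadow r@(inj₂ _) rel {s} q) ε with class-step {C} {C′} rel ε
    ... | c , _ , rel′ with retarget 𝓔 s c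
    ...   | just (_ , e) = shadow (target 𝓔 r c) rel′ (step q e)
    ...   | nothing      = restart C′

    record Tracks (x₀ : Vtx) {C : Class} (st : Shadow C) : Set where
      constructor tracks
      field
        admissible : Admissible game σ₁ x₀ (path st)
        on-anchor  : end st ≡ anchor st
        live       : Live 𝓔 (end st)
    open Tracks

    advance-tracks : ∀ {x₀ C C′} (st : Shadow C) (ε : C ⇒q C′) → Tracks x₀ st →
      ((o : ownerV (rep C) ≡ ○) → Follows reduced {C} (respond C st o) C′) →
      Σ (Edge (end st) (end (advance {C} {C′} st ε)))
        (λ e → path (advance {C} {C′} st ε) ≡ step (path st) e)
      × Tracks x₀ (advance {C} {C′} st ε)
    advance-tracks {C = C} {C′} (shadow (inj₁ _) rel q) ε (tracks (o , cp) refl _) follows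
      with σ₁ q refl in chosen
    ... | inj₂ stuck = contradiction (C′ , ε) (class-stuck {C} rel tt stuck)
    ... | inj₁ (y , e) rewrite proj₂ (retarget-label 𝓔 e) =
      (e , refl) , tracks (o , cp , follows-chosen game {σ₁} q chosen)
                          (cong rep (sym (follows (∼⇒owner≡ rel)))) (edge-live 𝓔 e)
    advance-tracks {C = C} {C′} (shadow r@(inj₂ _) rel q) ε (tracks (o , cp) refl live) _
      rewrite proj₂ (retarget-class-step {C} {C′} rel ε live) =
      (_ , refl) , tracks (o , cp , λ ()) refl tt

    trail : ∀ {C} → Path reduced C → Shadow C
    trail (start C)  = restart C
    trail (step p ε) = advance (trail p) ε

    σ₂ : Strategy○ reduced
    σ₂ {C} p = respond C (trail p)

    trail-tracks : ∀ {x₀ C} → Live 𝓔 x₀ → (p : Path reduced C) →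
                   Admissible reduced σ₂ [ x₀ ] p → Tracks x₀ (trail p)
    trail-tracks live (start C) (refl , _) = tracks (refl , lift tt) refl live
    trail-tracks live (step {C} {C′} p ε) (o , cp , follows) =
      proj₂ (advance-tracks {C = C} {C′} (trail p) ε (trail-tracks live p (o , cp)) follows)

    simulation : ∀ {x₀} → Live 𝓔 x₀ → Simulation σ₂ [ x₀ ] σ₁ x₀
    simulation {x₀} live = record
      { image            = λ p → end (trail p)
      ; trace            = λ p → path (trail p)
      ; trace-start      = λ _ → refl
      ; trace-step       = λ { {C} {C′} p ε (o , cp , follows) →
                               proj₁ (advance-tracks {C = C} {C′} (trail p) ε (tracked p (o , cp)) follows) }
      ; trace-admissible = λ p adm → admissible (tracked p adm)
      ; owner-image      = λ p adm → on-shadow ∼⇒owner≡ (trail p) (on-anchor (tracked p adm))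
      ; prio-image       = λ p adm → on-shadow ∼⇒prio≡ (trail p) (on-anchor (tracked p adm))
      ; dead-end         = λ { {C} p adm stuck →
                               inj₁ (subst (λ s → ¬ HasSucc game s) (sym (on-anchor (tracked p adm)))
                                       (member-stuck {C} (anchored (trail p)) stuck)) }
      }
      where
      tracked : ∀ {C} (p : Path reduced C) → Admissible reduced σ₂ [ x₀ ] p → Tracks x₀ (trail p)
      tracked = trail-tracks live

      on-shadow : ∀ {A : Set} {h : Vtx → A} → (∀ {x y} → x ∼ y → h x ≡ h y) →
                  ∀ {C} (st : Shadow C) → end st ≡ anchor st → h (end st) ≡ h (rep C)
      on-shadow {h = h} resp st on = trans (cong h on) (sym (resp (anchored st)))

  ○Wins-game⇒○Wins-reduced : ∀ {x₀} → Live 𝓔 x₀ → ○Wins game x₀ → ○Wins reduced [ x₀ ]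
  ○Wins-game⇒○Wins-reduced live (σ₁ , win) =
    σ₂ , simulation-winning (simulation live) win
    where open GameToQuotient σ₁

  module QuotientToGame (σ₂ : Strategy○ reduced) where

    -- Dually, on admissible histories `expected` is where the game play is (see Mirrors).
    record Mirror (x : Vtx) : Set₁ where
      constructor mirror
      field
        {class}   : Class
        path      : Path reduced class
        expected  : Vtx
        expected∈ : rep class ∼ expected
    open Mirror

    restart : (x : Vtx) → Mirror x
    restart x = mirror (start [ x ]) x ∼.refl

    σ₂-at : ∀ {C t} → Path reduced C → rep C ∼ t → (x : Vtx) → Maybe (HasSucc game x)
    σ₂-at {C} {inj₁ _} p rel x with σ₂ p (∼⇒owner≡ rel)
    ... | inj₁ (C′ , ε) = retarget 𝓔 x (proj₁ (class-step {C} {C′} rel ε))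
    ... | inj₂ _        = nothing
    σ₂-at {t = inj₂ _} _ _ _ = nothing

    fresh-move : ∀ {x} → ownerV x ≡ ○ → HasSucc game x ⊎ ¬ HasSucc game x
    fresh-move {x} o with σ₂ (start [ x ]) o
    ... | inj₁ (C′ , ε) = let c , en , _ = class-step {[ x ]} {C′} ∼.refl ε in
                          inj₁ (target 𝓔 x c , move-edge 𝓔 x c (en (○-live 𝓔 o)))
    ... | inj₂ stuck    = inj₂ (member-stuck {[ x ]} ∼.refl stuck)

    respond : (x : Vtx) → Mirror x → ownerV x ≡ ○ → HasSucc game x ⊎ ¬ HasSucc game x
    respond x (mirror p t rel) o with σ₂-at p rel x
    ... | just move = inj₁ move
    ... | nothing   = fresh-move o

    advance : ∀ {x x′} → Mirror x → Edge x x′ → Mirror x′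
    advance {x′ = x′} (mirror {class = C} p (inj₁ _) rel) (orE _ _ _ _ _) with σ₂ p (∼⇒owner≡ rel)
    ... | inj₁ (C′ , ε) = let c , _ , rel′ = class-step {C} {C′} rel ε in
                          mirror {class = C′} (step p ε) (target 𝓔 _ c) rel′
    ... | inj₂ _        = restart x′
    advance {x′ = x′} (mirror p (inj₂ _) _) (orE _ _ _ _ _) = restart x′
    advance {x′ = x′} (mirror {class = C} p t rel) e@(andE _ _ _ _ _ _) with retarget 𝓔 t (label 𝓔 e)
    ... | just (y , e′) = mirror {class = [ y ]} (step p (class-edge {C} rel e′)) y ∼.refl
    ... | nothing       = restart x′

    record Mirrors (x₀ : Vtx) {x : Vtx} (st : Mirror x) : Set₁ where
      constructor mirrors
      field
        admissible  : Admissible reduced σ₂ [ x₀ ] (path st)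
        on-expected : expected st ≡ x
    open Mirrors

    advance-mirrors : ∀ {x₀ x x′} (st : Mirror x) (e : Edge x x′) → Mirrors x₀ st →
      ((o : ownerV x ≡ ○) → Follows game (respond x st o) x′) →
      Σ (class st ⇒q class (advance st e)) (λ ε → path (advance st e) ≡ step (path st) ε)
      × Mirrors x₀ (advance st e)
    advance-mirrors (mirror {class = C} p _ rel) e@(orE _ _ _ _ _) (mirrors (o , cp) refl) follows
      with σ₂ p (∼⇒owner≡ rel) in chosen
    ... | inj₂ stuck    = contradiction (_ , e) (member-stuck {C} rel stuck)
    ... | inj₁ (C′ , ε) rewrite proj₂ (retarget-class-step {C} {C′} rel ε tt) =
      (ε , refl) , mirrors (o , cp , follows-chosen reduced {σ₂} {C} p chosen) (sym (follows refl))
    advance-mirrors (mirror {class = C} p _ rel) e@(andE _ _ _ _ _ _) (mirrors (o , cp) refl) _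
      rewrite proj₂ (retarget-label 𝓔 e) =
      (_ , refl) , mirrors (o , cp , λ o′ → contradiction (trans (sym o′) (∼⇒owner≡ rel)) λ ()) refl

    trail : ∀ {x} → Path game x → Mirror x
    trail (start x)  = restart x
    trail (step q e) = advance (trail q) e

    σ₁ : Strategy○ game
    σ₁ {x} q = respond x (trail q)

    trail-mirrors : ∀ {x₀ x} (q : Path game x) → Admissible game σ₁ x₀ q → Mirrors x₀ (trail q)
    trail-mirrors (start x)  (refl , _)          = mirrors (refl , lift tt) refl
    trail-mirrors (step q e) (o , cp , follows) =
      proj₂ (advance-mirrors (trail q) e (trail-mirrors q (o , cp)) follows)

    simulation : ∀ {x₀} → Simulation σ₁ x₀ σ₂ [ x₀ ]
    simulation = record
      { image            = λ q → class (trail q)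
      ; trace            = λ q → path (trail q)
      ; trace-start      = λ _ → refl
      ; trace-step       = λ { q e (o , cp , follows) →
                               proj₁ (advance-mirrors (trail q) e (trail-mirrors q (o , cp)) follows) }
      ; trace-admissible = λ q adm → admissible (trail-mirrors q adm)
      ; owner-image      = λ q adm → on-class ∼⇒owner≡ (trail q) (on-expected (trail-mirrors q adm))
      ; prio-image       = λ q adm → on-class ∼⇒prio≡ (trail q) (on-expected (trail-mirrors q adm))
      ; dead-end         = λ q adm → stuck-or-□ (trail q) (on-expected (trail-mirrors q adm))
      }
      where
      on-class : ∀ {A : Set} {h : Vtx → A} → (∀ {x y} → x ∼ y → h x ≡ h y) →
                 ∀ {x} (st : Mirror x) → expected st ≡ x → h (rep (class st)) ≡ h x
      on-class resp (mirror _ _ rel) refl = resp rel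

      stuck-or-□ : ∀ {x} (st : Mirror x) → expected st ≡ x → ¬ HasSucc game x →
                   ¬ HasSucc reduced (class st) ⊎ ownerV x ≡ □
      stuck-or-□ {inj₁ _} (mirror {class = C} _ _ rel) refl stuck = inj₁ (class-stuck {C} rel tt stuck)
      stuck-or-□ {inj₂ _} _                              _    _     = inj₂ refl

  ○Wins-reduced⇒○Wins-game : ∀ {x₀} → ○Wins reduced [ x₀ ] → ○Wins game x₀
  ○Wins-reduced⇒○Wins-game (σ₂ , win) = σ₁ , simulation-winning simulation win
    where open QuotientToGame σ₂

lemma3 : (𝓔 : PBES) (_∼D_ : Rel (PBESGame.Sig 𝓔) 0ℓ) (_∼B_ : Rel (PBESGame.B 𝓔) 0ℓ)
    → PBESGame.Feasible 𝓔 _∼D_ _∼B_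
    → (i : Fin (PBES.n 𝓔)) (v : PBES.D 𝓔 i)
    → ○Wins (PBESGame.game 𝓔) (inj₁ (i , v))
      ⇔ ○Wins (PBESGame.Reduced.reduced 𝓔 _∼D_ _∼B_)
          (PBESGame.Reduced.[_] 𝓔 _∼D_ _∼B_ (inj₁ (i , v)))
lemma3 𝓔 _∼D_ _∼B_ feasible i v =
  mk⇔ (○Wins-game⇒○Wins-reduced 𝓔 _∼D_ _∼B_ feasible tt)
      (○Wins-reduced⇒○Wins-game 𝓔 _∼D_ _∼B_ feasible)
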